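{- Let $n=n_1n_2$ with integers $n_1\geq1$, $n_2\geq3$, and let $I=(n_1)$ and $J=(n_2)$ be the ideals of $\mathbb Z_n$ generated by $n_1$ and $n_2$. If $e$ is the largest element of $I$ with respect to $\leq$, then $e\in J+1$ and $e$ is the smallest element of $J+1$ with respect to $\leq$.
   Context: On $\mathbb Z_n$ define the partial order $\leq$ by: $a\leq b$ iff $a=b$ or $a\equiv ab\pmod n$. $J+1=\{y+1: y\in J\}$. -}

module Defs where

open import Data.Nat using (ℕ; _+_; _*_; NonZero)
open import Data.Nat.DivMod using (_%_)
open import Data.Fin using (Fin; toℕ)
open import Data.Product using (∃; Σ; _×_)
open import Data.Sum using (_⊎_)
open import Relation.Binary.PropositionalEquality using (_≡_)

-- ℤ_n is represented by Fin n (residues 0..n-1); ring operations are taken mod n.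

Leq : (n : ℕ) .{{_ : NonZero n}} → Fin n → Fin n → Set
Leq n a b = (a ≡ b) ⊎ (toℕ a ≡ (toℕ a * toℕ b) % n)

InIdeal : (n : ℕ) .{{_ : NonZero n}} → ℕ → Fin n → Set
InIdeal n m x = ∃ λ (r : Fin n) → toℕ x ≡ (m * toℕ r) % n

InShiftedIdeal : (n : ℕ) .{{_ : NonZero n}} → ℕ → Fin n → Set
InShiftedIdeal n m x = ∃ λ (y : Fin n) → InIdeal n m y × (toℕ x ≡ (toℕ y + 1) % n)

IsLargestInIdeal : (n : ℕ) .{{_ : NonZero n}} → ℕ → Fin n → Set
IsLargestInIdeal n m e = InIdeal n m e × (∀ x → InIdeal n m x → Leq n x e)

IsSmallestInShifted : (n : ℕ) .{{_ : NonZero n}} → ℕ → Fin n → Set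
IsSmallestInShifted n m e = InShiftedIdeal n m e × (∀ x → InShiftedIdeal n m x → Leq n e x)

-- The elements of I are the multiples of n₁ and those of J + 1 the residues ≡ 1 (mod n₂).
-- If e = cn₁ and x = 1 + bn₂ then ex = e + cb·n₁n₂, so every element of I lies below every
-- element of J + 1, and it remains to show that the largest e ∈ I is ≡ 1 (mod n₂). Of the
-- two distinct elements n₁ and n₁(n₂ − 1) of I at least one, n₁k, differs from e, so
-- n₁k ≡ n₁ke (mod n₁n₂), i.e. k ≡ ke (mod n₂); as k² ≡ 1 (mod n₂), multiplying by k
-- gives e ≡ 1 (mod n₂).
module Submission where

open import Defs
open import Data.Nat using (ℕ; _*_; _≤_; NonZero)
open import Data.Fin using (Fin)
open import Data.Product using (_×_)
open import Relation.Binary.PropositionalEquality using (_≡_)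

open import Data.Nat using (suc; _+_; _<_; _/_; _%_; s≤s; z≤n)
open import Data.Nat.Properties
open import Data.Nat.DivMod
open import Data.Nat.Divisibility using (_∣_; divides; ∣-trans; ∣m+n∣m⇒∣n; m∣m*n; n∣m*n)
open import Data.Nat.Tactic.RingSolver using (solve-∀)
open import Data.Fin using (toℕ; fromℕ<) renaming (_≟_ to _≟ᶠ_)
open import Data.Fin.Properties using (toℕ-fromℕ<; toℕ<n)
open import Data.Product using (_,_)
open import Data.Sum using (_⊎_; inj₁; inj₂; [_,_]′)
open import Relation.Nullary using (yes; no; contradiction)
open import Relation.Binary.PropositionalEquality
  using (_≢_; refl; sym; trans; cong; subst; module ≡-Reasoning)
open ≡-Reasoning

[m*n]%[m*o]≡m*[n%o] : ∀ m n o .{{_ : NonZero m}} .{{_ : NonZero o}} .{{_ : NonZero (m * o)}} →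
                      (m * n) % (m * o) ≡ m * (n % o)
[m*n]%[m*o]≡m*[n%o] m n o = begin
  (m * n) % (m * o)                             ≡⟨ cong (λ z → (m * z) % (m * o)) (m≡m%n+[m/n]*n n o) ⟩
  (m * (n % o + n / o * o)) % (m * o)           ≡⟨ cong (_% (m * o)) (distrib m (n % o) (n / o) o) ⟩
  (m * (n % o) + n / o * (m * o)) % (m * o)     ≡⟨ [m+kn]%n≡m%n (m * (n % o)) (n / o) (m * o) ⟩
  (m * (n % o)) % (m * o)                       ≡⟨ m<n⇒m%n≡m (*-monoʳ-< m (m%n<n n o)) ⟩
  m * (n % o)                                   ∎
  where
  distrib : ∀ m r q o → m * (r + q * o) ≡ m * r + q * (m * o)
  distrib = solve-∀

cancel-unit-% : ∀ {j k m d} .{{_ : NonZero d}} →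
                (j * k) % d ≡ 1 → k % d ≡ (k * m) % d → m % d ≡ 1
cancel-unit-% {j} {k} {m} {d} jk≡1 k≡km = begin
  m % d                            ≡⟨ m%n%n≡m%n m d ⟨
  m % d % d                        ≡⟨ cong (_% d) (*-identityˡ (m % d)) ⟨
  (1 * (m % d)) % d                ≡⟨ cong (λ z → (z * (m % d)) % d) jk≡1 ⟨
  ((j * k) % d * (m % d)) % d      ≡⟨ %-distribˡ-* (j * k) m d ⟨
  (j * k * m) % d                  ≡⟨ cong (_% d) (*-assoc j k m) ⟩
  (j * (k * m)) % d                ≡⟨ %-distribˡ-* j (k * m) d ⟩
  (j % d * ((k * m) % d)) % d      ≡⟨ cong (λ z → (j % d * z) % d) k≡km ⟨
  (j % d * (k % d)) % d            ≡⟨ %-distribˡ-* j k d ⟨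
  (j * k) % d                      ≡⟨ jk≡1 ⟩
  1                                ∎

[1+q]²%[2+q]≡1 : ∀ q → (suc q * suc q) % (2 + q) ≡ 1
[1+q]²%[2+q]≡1 q = begin
  (suc q * suc q) % (2 + q)        ≡⟨ cong (_% (2 + q)) (square q) ⟩
  (1 + q * (2 + q)) % (2 + q)      ≡⟨ [m+kn]%n≡m%n 1 q (2 + q) ⟩
  1 % (2 + q)                      ≡⟨ m<n⇒m%n≡m {n = 2 + q} (s≤s (s≤s z≤n)) ⟩
  1                                ∎
  where
  square : ∀ q → suc q * suc q ≡ 1 + q * (2 + q)
  square = solve-∀

multiple-absorbs-%≡1 : ∀ {m d a b} .{{_ : NonZero d}} .{{_ : NonZero (m * d)}} →
                       m ∣ a → b % d ≡ 1 → a < m * d → a ≡ (a * b) % (m * d)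
multiple-absorbs-%≡1 {m} {d} {a} {b} (divides c refl) b%d≡1 a<md = begin
  c * m                                     ≡⟨ m<n⇒m%n≡m a<md ⟨
  (c * m) % (m * d)                         ≡⟨ [m+kn]%n≡m%n (c * m) (c * (b / d)) (m * d) ⟨
  (c * m + c * (b / d) * (m * d)) % (m * d) ≡⟨ cong (_% (m * d)) (expand c m (b / d) d) ⟩
  (c * m * (1 + b / d * d)) % (m * d)       ≡⟨ cong (λ z → (c * m * (z + b / d * d)) % (m * d)) b%d≡1 ⟨
  (c * m * (b % d + b / d * d)) % (m * d)   ≡⟨ cong (λ z → (c * m * z) % (m * d)) (m≡m%n+[m/n]*n b d) ⟨
  (c * m * b) % (m * d)                     ∎
  where
  expand : ∀ c m q d → c * m + c * q * (m * d) ≡ c * m * (1 + q * d)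
  expand = solve-∀

≢-either : ∀ {n} {x y : Fin n} → x ≢ y → ∀ z → x ≢ z ⊎ y ≢ z
≢-either {x = x} x≢y z with z ≟ᶠ x
... | yes refl = inj₂ (λ y≡x → x≢y (sym y≡x))
... | no z≢x   = inj₁ (λ x≡z → z≢x (sym x≡z))

module _ {n m : ℕ} .{{_ : NonZero n}} where

  inIdeal⇒∣ : ∀ {x : Fin n} → m ∣ n → InIdeal n m x → m ∣ toℕ x
  inIdeal⇒∣ {x} m∣n (r , x≡) = ∣m+n∣m⇒∣n m∣sum (∣-trans m∣n (n∣m*n q))
    where
    q = (m * toℕ r) / n
    m∣sum : m ∣ q * n + toℕ x
    m∣sum rewrite x≡ | +-comm (q * n) ((m * toℕ r) % n) | sym (m≡m%n+[m/n]*n (m * toℕ r) n) =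
      m∣m*n (toℕ r)

  fromℕ<-inIdeal : ∀ {k} (k<n : k < n) (mk<n : m * k < n) → InIdeal n m (fromℕ< mk<n)
  fromℕ<-inIdeal {k} k<n mk<n = fromℕ< k<n , (begin
    toℕ (fromℕ< mk<n)            ≡⟨ toℕ-fromℕ< mk<n ⟩
    m * k                        ≡⟨ m<n⇒m%n≡m mk<n ⟨
    (m * k) % n                  ≡⟨ cong (λ z → (m * z) % n) (toℕ-fromℕ< k<n) ⟨
    (m * toℕ (fromℕ< k<n)) % n   ∎)

  module _ .{{_ : NonZero m}} where

    inShiftedIdeal⇒%≡1 : ∀ {x : Fin n} → m ∣ n → 1 < m → InShiftedIdeal n m x → toℕ x % m ≡ 1
    inShiftedIdeal⇒%≡1 {x} m∣n 1<m (y , y∈J , x≡y+1) = begin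
      toℕ x % m                ≡⟨ cong (_% m) x≡y+1 ⟩
      (toℕ y + 1) % n % m      ≡⟨ m∣n⇒o%n%m≡o%m m n (toℕ y + 1) m∣n ⟩
      (toℕ y + 1) % m          ≡⟨ %-remove-+ˡ 1 (inIdeal⇒∣ m∣n y∈J) ⟩
      1 % m                    ≡⟨ m<n⇒m%n≡m 1<m ⟩
      1                        ∎

    %≡1⇒inShiftedIdeal : ∀ {x : Fin n} → toℕ x % m ≡ 1 → InShiftedIdeal n m x
    %≡1⇒inShiftedIdeal {x} x%m≡1 = fromℕ< mq<n , fromℕ<-inIdeal q<n mq<n , (begin
      toℕ x                      ≡⟨ m<n⇒m%n≡m (toℕ<n x) ⟨
      toℕ x % n                  ≡⟨ cong (_% n) x≡mq+1 ⟩
      (m * q + 1) % n            ≡⟨ cong (λ z → (z + 1) % n) (toℕ-fromℕ< mq<n) ⟨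
      (toℕ (fromℕ< mq<n) + 1) % n ∎)
      where
      q = toℕ x / m
      x≡mq+1 : toℕ x ≡ m * q + 1
      x≡mq+1 = begin
        toℕ x              ≡⟨ m≡m%n+[m/n]*n (toℕ x) m ⟩
        toℕ x % m + q * m  ≡⟨ cong (_+ q * m) x%m≡1 ⟩
        1 + q * m          ≡⟨ +-comm 1 (q * m) ⟩
        q * m + 1          ≡⟨ cong (_+ 1) (*-comm q m) ⟩
        m * q + 1          ∎
      q<n : q < n
      q<n = ≤-<-trans (m/n≤m (toℕ x) m) (toℕ<n x)
      mq<n : m * q < n
      mq<n = ≤-<-trans (subst (_≤ toℕ x) (*-comm q m) (m/n*n≤m (toℕ x) m)) (toℕ<n x)

module _ {n₁ n₂ : ℕ} .{{_ : NonZero n₁}} .{{_ : NonZero n₂}} where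

  private instance
    n₁n₂≢0 : NonZero (n₁ * n₂)
    n₁n₂≢0 = m*n≢0 n₁ n₂

  strictly-below-by-unit⇒%≡1 : ∀ {j k} {x e : Fin (n₁ * n₂)} → toℕ x ≡ n₁ * k → k < n₂ →
                               (j * k) % n₂ ≡ 1 → x ≢ e → Leq (n₁ * n₂) x e → toℕ e % n₂ ≡ 1
  strictly-below-by-unit⇒%≡1 _ _ _ x≢e (inj₁ x≡e) = contradiction x≡e x≢e
  strictly-below-by-unit⇒%≡1 {j} {k} {x} {e} x≡n₁k k<n₂ jk≡1 _ (inj₂ x≡xe) =
    cancel-unit-% {j} jk≡1 (trans (m<n⇒m%n≡m k<n₂) (*-cancelˡ-≡ k ((k * E) % n₂) n₁ n₁k≡n₁[kE%n₂]))
    where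
    E = toℕ e
    n₁k≡n₁[kE%n₂] : n₁ * k ≡ n₁ * ((k * E) % n₂)
    n₁k≡n₁[kE%n₂] = begin
      n₁ * k                         ≡⟨ x≡n₁k ⟨
      toℕ x                          ≡⟨ x≡xe ⟩
      (toℕ x * E) % (n₁ * n₂)        ≡⟨ cong (λ z → (z * E) % (n₁ * n₂)) x≡n₁k ⟩
      (n₁ * k * E) % (n₁ * n₂)       ≡⟨ cong (_% (n₁ * n₂)) (*-assoc n₁ k E) ⟩
      (n₁ * (k * E)) % (n₁ * n₂)     ≡⟨ [m*n]%[m*o]≡m*[n%o] n₁ (k * E) n₂ ⟩
      n₁ * ((k * E) % n₂)            ∎

  n₁·_ : ∀ {k} → k < n₂ → Fin (n₁ * n₂)
  n₁· k<n₂ = fromℕ< (*-monoʳ-< n₁ k<n₂)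

  largest-above-multiple : ∀ {k} {e : Fin (n₁ * n₂)} → IsLargestInIdeal (n₁ * n₂) n₁ e →
                           (k<n₂ : k < n₂) → Leq (n₁ * n₂) (n₁· k<n₂) e
  largest-above-multiple (_ , largest) k<n₂ =
    largest _ (fromℕ<-inIdeal {m = n₁} (<-≤-trans k<n₂ (m≤n*m n₂ n₁)) (*-monoʳ-< n₁ k<n₂))

  largestInIdeal⇒%≡1 : 3 ≤ n₂ → ∀ {e} → IsLargestInIdeal (n₁ * n₂) n₁ e → toℕ e % n₂ ≡ 1
  largestInIdeal⇒%≡1 (s≤s (s≤s (s≤s {n = t} z≤n))) {e} e-largest =
    [ below-by-unit 1<n₂ (m<n⇒m%n≡m 1<n₂) , below-by-unit p<n₂ ([1+q]²%[2+q]≡1 (suc t)) ]′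
      (≢-either n₁·1≢n₁·p e)
    where
    1<n₂ : 1 < n₂
    1<n₂ = s≤s (s≤s z≤n)
    p<n₂ : 2 + t < n₂
    p<n₂ = ≤-refl
    n₁·1≢n₁·p : n₁· 1<n₂ ≢ n₁· p<n₂
    n₁·1≢n₁·p eq = contradiction (*-cancelˡ-≡ 1 (2 + t) n₁ n₁≡n₁[2+t]) λ ()
      where
      n₁≡n₁[2+t] : n₁ * 1 ≡ n₁ * (2 + t)
      n₁≡n₁[2+t] = trans (sym (toℕ-fromℕ< _)) (trans (cong toℕ eq) (toℕ-fromℕ< _))
    below-by-unit : ∀ {k} (k<n₂ : k < n₂) → (k * k) % n₂ ≡ 1 → n₁· k<n₂ ≢ e → toℕ e % n₂ ≡ 1
    below-by-unit {k} k<n₂ k²≡1 n₁k≢e =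
      strictly-below-by-unit⇒%≡1 {j = k} (toℕ-fromℕ< _) k<n₂ k²≡1 n₁k≢e (largest-above-multiple e-largest k<n₂)

lemma3p6 : (n₁ n₂ n : ℕ) .{{_ : NonZero n}} → 1 ≤ n₁ → 3 ≤ n₂ → n ≡ n₁ * n₂ →
    (e : Fin n) → IsLargestInIdeal n n₁ e →
    InShiftedIdeal n n₂ e × IsSmallestInShifted n n₂ e
lemma3p6 n₁@(suc _) n₂@(suc (suc _)) n (s≤s z≤n) 3≤n₂@(s≤s (s≤s _)) refl e e-largest@(e∈I , _) =
  e∈J+1 , e∈J+1 , e-smallest
  where
  e∈J+1 : InShiftedIdeal n n₂ e
  e∈J+1 = %≡1⇒inShiftedIdeal (largestInIdeal⇒%≡1 {n₁} 3≤n₂ e-largest)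
  e-smallest : ∀ x → InShiftedIdeal n n₂ x → Leq n e x
  e-smallest x x∈J+1 = inj₂ (multiple-absorbs-%≡1 {n₁}
    (inIdeal⇒∣ {m = n₁} (m∣m*n n₂) e∈I) (inShiftedIdeal⇒%≡1 (n∣m*n n₁) (s≤s (s≤s z≤n)) x∈J+1) (toℕ<n e))
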